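{- For every integer $n \ge 2$ there exists a graph $G$ with $\Delta(G) = n+1$ and $\mathrm{mad}(G) < 4$ such that $G^2$ contains a clique on $2\Delta(G)+2$ vertices; in particular $\chi(G^2) \ge 2\Delta(G) + 2$.
   Context: For a graph $G$, $\Delta(G)$ is its maximum degree and $\chi$ denotes chromatic number. The square $G^2$ of $G$ is the graph on $V(G)$ in which two distinct vertices are adjacent iff their distance in $G$ is at most $2$. The maximum average degree $\mathrm{mad}(G)$ is the maximum, over all subgraphs $H$ of $G$ with $V(H)\neq\emptyset$, of $2|E(H)|/|V(H)|$. -}

module Defs where

open import Data.Bool using (Bool; true; false; if_then_else_; _∨_; _∧_; not)
open import Data.Nat using (ℕ; zero; suc; _+_; _*_; _≤_; _<_; _⊔_; _<ᵇ_)
open import Data.Fin using (Fin; toℕ)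
open import Data.Fin.Properties using (_≟_)
open import Data.List using (List; map; foldr; allFin)
open import Data.Nat.ListAction using (sum)
open import Data.Bool.ListAction using (any)
open import Data.Product using (Σ; _×_; _,_)
open import Relation.Nullary using (¬_; does)
open import Relation.Binary.PropositionalEquality using (_≡_)
open import Function.Definitions using (Injective)

record Graph : Set where
  field
    V      : ℕ
    adj    : Fin V → Fin V → Bool
    sym    : ∀ u v → adj u v ≡ adj v u
    irrefl : ∀ v → adj v v ≡ false
open Graph public

countTrue : (n : ℕ) → (Fin n → Bool) → ℕ
countTrue n f = sum (map (λ i → if f i then 1 else 0) (allFin n))

deg : (G : Graph) → Fin (V G) → ℕ
deg G v = countTrue (V G) (adj G v)

Δ : Graph → ℕ
Δ G = foldr _⊔_ 0 (map (deg G) (allFin (V G)))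

record Subgraph (G : Graph) : Set where
  field
    S     : Fin (V G) → Bool
    F     : Fin (V G) → Fin (V G) → Bool
    Fsym  : ∀ u v → F u v ≡ F v u
    F⊆E   : ∀ u v → F u v ≡ true → adj G u v ≡ true
    F⊆S   : ∀ u v → F u v ≡ true → S u ≡ true
open Subgraph public

vcount : {G : Graph} → Subgraph G → ℕ
vcount {G} H = countTrue (V G) (S H)

ecount : {G : Graph} → Subgraph G → ℕ
ecount {G} H = sum (map (λ u → countTrue (V G) (λ v → (toℕ u <ᵇ toℕ v) ∧ F H u v)) (allFin (V G)))

-- mad(G) < k  (for a natural number k): unfolding the definition of mad as a
-- maximum over the finitely many subgraphs H with V(H) ≠ ∅ of 2|E(H)|/|V(H)|,
-- this says 2|E(H)|/|V(H)| < k, i.e. 2|E(H)| < k·|V(H)|, for every such H.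
madLessThan : Graph → ℕ → Set
madLessThan G k = (H : Subgraph G) → 0 < vcount H → 2 * ecount H < k * vcount H

sqAdj : (G : Graph) → Fin (V G) → Fin (V G) → Bool
sqAdj G u v = not (does (u ≟ v)) ∧ (adj G u v ∨ any (λ w → adj G u w ∧ adj G w v) (allFin (V G)))

HasClique : {N : ℕ} → (Fin N → Fin N → Bool) → ℕ → Set
HasClique {N} A m = Σ (Fin m → Fin N) λ f →
  Injective _≡_ _≡_ f × (∀ a b → ¬ (a ≡ b) → A (f a) (f b) ≡ true)

ChromaticAtLeast : {N : ℕ} → (Fin N → Fin N → Bool) → ℕ → Set
ChromaticAtLeast {N} A m = (k : ℕ) (c : Fin N → Fin k) →
  (∀ u v → A u v ≡ true → ¬ (c u ≡ c v)) → m ≤ k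

-- Let m = n − 1 ≥ 1. Take vertices p₁ … pₘ, q₁ … qₘ, a private common
-- neighbour cᵢⱼ of every pair pᵢ, qⱼ, two edges h₁h₂ and h₃h₄, and two
-- vertices x, y with a common neighbour, the hub; join every pᵢ to h₂, h₄, every qⱼ
-- to h₁, h₃, x to h₂, h₃ and y to h₁, h₄. The 2m + 6 vertices p, q, x, y, h
-- are pairwise at distance at most 2, so they form a clique of size
-- 2Δ + 2 in G², where Δ = m + 2 is the degree of h₁. In the order
-- c, hub, p, q, y, x, h₁, …, h₄ every vertex has at most two later neighbours;
-- hence a subgraph on k vertices has fewer than 2k edges (its last vertex
-- has no later neighbour), i.e. mad(G) < 4.
module Submission where

open import Defs hiding (sym)
open import Data.Bool using (Bool; true; false; if_then_else_; _∨_; _∧_; T)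
open import Data.Bool.Properties using (∨-comm; ∨-identityʳ; ¬-not; T-≡)
open import Data.Fin using (Fin; zero; suc; toℕ; _↑ˡ_; _↑ʳ_; combine; remQuot; splitAt)
open import Data.Fin.Patterns using (0F; 1F; 2F; 3F; 4F; 5F)
open import Data.Fin.Properties
  using (_≟_; any?; toℕ-↑ˡ; toℕ-↑ʳ; toℕ<n; splitAt-↑ˡ; splitAt-↑ʳ; splitAt⁻¹-↑ˡ; splitAt⁻¹-↑ʳ;
         remQuot-combine; combine-remQuot; injective⇒≤)
open import Data.List using (map; foldr; tabulate)
open import Data.List.Membership.Propositional using (_∈_)
open import Data.List.Membership.Propositional.Properties using (∈-map⁺; ∈-allFin)
open import Data.List.Properties using (foldr-preservesᵇ)
import Data.List.Relation.Unary.All.Properties as All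
import Data.List.Relation.Unary.Any as Any
open import Data.List.Relation.Unary.Any using (here; there)
open import Data.List.Relation.Unary.Any.Properties using (any⁺)
open import Data.Nat using (ℕ; zero; suc; _+_; _*_; _≤_; _<_; _⊔_; _<ᵇ_; z≤n; s≤s)
import Data.Nat.ListAction as ListAction
open import Data.Nat.Properties
  using (≤-refl; ≤-reflexive; ≤-trans; <-≤-trans; ≤-antisym; <-asym; +-mono-≤; +-mono-<-≤;
         +-mono-≤-<; +-monoʳ-<; *-monoʳ-<; *-assoc; *-identityʳ; *-zeroʳ; +-assoc; +-suc;
         ⊔-lub; m≤m⊔n; m≤n⇒m≤o⊔n; m≤m+n; m≤n+m; <ᵇ⇒<; +-*-semiring; module ≤-Reasoning)
open import Algebra.Properties.Semiring.Sum +-*-semiring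
  using (sum-syntax; sum-cong-≗; sum-replicate-zero; ∑-comm; *-distribˡ-sum)
open import Data.Nat.Solver using (module +-*-Solver)
open import Data.Product using (Σ; _×_; _,_; ∃; proj₁; proj₂; uncurry)
open import Data.Sum using (inj₁; inj₂; [_,_]′)
open import Function using (_∘_; id; Equivalence)
open import Relation.Nullary using (¬_; does; yes; no; contradiction)
open import Relation.Nullary.Decidable using (dec-true)
open import Relation.Binary.PropositionalEquality
  using (_≡_; refl; sym; trans; cong; cong₂; subst; subst₂; module ≡-Reasoning)

-- Finite sums

𝟙 : Bool → ℕ
𝟙 b = if b then 1 else 0

sum-map-tabulate : ∀ {A : Set} {n} (g : Fin n → A) (h : A → ℕ) →
  ListAction.sum (map h (tabulate g)) ≡ ∑[ i < n ] h (g i)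
sum-map-tabulate {n = zero} g h = refl
sum-map-tabulate {n = suc n} g h = cong (h (g zero) +_) (sum-map-tabulate (g ∘ suc) h)

∑-cong : ∀ {A : Set} {n} (h : A → ℕ) {φ ψ : Fin n → A} → (∀ i → φ i ≡ ψ i) →
  ∑[ i < n ] h (φ i) ≡ ∑[ i < n ] h (ψ i)
∑-cong h φ≗ψ = sum-cong-≗ (cong h ∘ φ≗ψ)

∑-mono-≤ : ∀ {n} {f g : Fin n → ℕ} → (∀ i → f i ≤ g i) → ∑[ i < n ] f i ≤ ∑[ i < n ] g i
∑-mono-≤ {zero} f≤g = z≤n
∑-mono-≤ {suc n} f≤g = +-mono-≤ (f≤g zero) (∑-mono-≤ (f≤g ∘ suc))

∑-mono-< : ∀ {n} {f g : Fin n → ℕ} → (∀ i → f i ≤ g i) → ∀ i → f i < g i →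
  ∑[ i < n ] f i < ∑[ i < n ] g i
∑-mono-< {suc n} f≤g zero f<g = +-mono-<-≤ f<g (∑-mono-≤ (f≤g ∘ suc))
∑-mono-< {suc n} f≤g (suc i) f<g = +-mono-≤-< (f≤g zero) (∑-mono-< (f≤g ∘ suc) i f<g)

∑-++ : ∀ m {n} (f : Fin (m + n) → ℕ) →
  ∑[ k < m + n ] f k ≡ ∑[ i < m ] f (i ↑ˡ n) + ∑[ j < n ] f (m ↑ʳ j)
∑-++ zero f = refl
∑-++ (suc m) f = trans (cong (f zero +_) (∑-++ m (f ∘ suc))) (sym (+-assoc (f zero) _ _))

∑-combine : ∀ m {n} (f : Fin (m * n) → ℕ) →
  ∑[ k < m * n ] f k ≡ ∑[ i < m ] ∑[ j < n ] f (combine i j)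
∑-combine zero f = refl
∑-combine (suc m) {n} f = trans (∑-++ n f) (cong (∑[ j < n ] f (j ↑ˡ (m * n)) +_) (∑-combine m (f ∘ (n ↑ʳ_))))

∑-one : ∀ n → ∑[ i < n ] 1 ≡ n
∑-one zero = refl
∑-one (suc n) = cong suc (∑-one n)

∑∑-zero : ∀ m n → ∑[ i < m ] ∑[ j < n ] 0 ≡ 0
∑∑-zero m n = trans (∑-cong {n = m} id (λ _ → sum-replicate-zero n)) (sum-replicate-zero m)

∑-𝟙-≟ˡ : ∀ {n} (i : Fin n) → ∑[ j < n ] 𝟙 (does (i ≟ j)) ≡ 1
∑-𝟙-≟ˡ {suc n} zero = cong suc (sum-replicate-zero n)
∑-𝟙-≟ˡ {suc n} (suc i) = ∑-𝟙-≟ˡ i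

∑-𝟙-≟ʳ : ∀ {n} (i : Fin n) → ∑[ j < n ] 𝟙 (does (j ≟ i)) ≡ 1
∑-𝟙-≟ʳ {suc n} zero = cong suc (sum-replicate-zero n)
∑-𝟙-≟ʳ {suc n} (suc i) = ∑-𝟙-≟ʳ i

∑𝟙-pos⇒∃ : ∀ {n} (f : Fin n → Bool) → 0 < ∑[ i < n ] 𝟙 (f i) → ∃ λ i → f i ≡ true
∑𝟙-pos⇒∃ {suc n} f pos with f zero in f0
... | true = zero , f0
... | false = let i , fi = ∑𝟙-pos⇒∃ (f ∘ suc) pos in suc i , fi

lastTrue : ∀ {n} (f : Fin n → Bool) → ∃ (λ i → f i ≡ true) →
  ∃ λ u → f u ≡ true × (∀ v → toℕ u < toℕ v → f v ≡ false)
lastTrue {suc n} f (i , fi) with any? (λ j → f (suc j) Data.Bool.≟ true)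
... | yes later = let u , fu , after = lastTrue (f ∘ suc) later
                  in suc u , fu , λ { zero () ; (suc v) (s≤s u<v) → after v u<v }
... | no none = zero , f0 i fi , λ { zero () ; (suc v) _ → ¬-not (λ fv → none (v , fv)) }
  where
  f0 : ∀ i → f i ≡ true → f zero ≡ true
  f0 zero fi = fi
  f0 (suc i) fi = contradiction (i , fi) none

↑ˡ<↑ʳ : ∀ {m n} (i : Fin m) (j : Fin n) → toℕ (i ↑ˡ n) < toℕ (m ↑ʳ j)
↑ˡ<↑ʳ {m} {n} i j rewrite toℕ-↑ˡ i n | toℕ-↑ʳ m j = <-≤-trans (toℕ<n i) (m≤m+n m (toℕ j))

↑ʳ-mono-< : ∀ m {n} {i j : Fin n} → toℕ i < toℕ j → toℕ (m ↑ʳ i) < toℕ (m ↑ʳ j)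
↑ʳ-mono-< m {i = i} {j} i<j rewrite toℕ-↑ʳ m i | toℕ-↑ʳ m j = +-monoʳ-< m i<j

-- Degrees, maximum average degree and cliques

countTrue≡∑ : ∀ n (f : Fin n → Bool) → countTrue n f ≡ ∑[ i < n ] 𝟙 (f i)
countTrue≡∑ n f = sum-map-tabulate id (𝟙 ∘ f)

ecount≡∑ : ∀ {G} (H : Subgraph G) →
  ecount H ≡ ∑[ u < V G ] ∑[ v < V G ] 𝟙 ((toℕ u <ᵇ toℕ v) ∧ F H u v)
ecount≡∑ {G} H = trans (sum-map-tabulate id (λ u → countTrue (V G) (forward u)))
                       (sum-cong-≗ (λ u → countTrue≡∑ (V G) (forward u)))
  where
  forward : Fin (V G) → Fin (V G) → Bool
  forward u v = (toℕ u <ᵇ toℕ v) ∧ F H u v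

∈⇒≤-foldr-⊔ : ∀ {x xs} → x ∈ xs → x ≤ foldr _⊔_ 0 xs
∈⇒≤-foldr-⊔ (here refl) = m≤m⊔n _ _
∈⇒≤-foldr-⊔ (there x∈xs) = m≤n⇒m≤o⊔n _ (∈⇒≤-foldr-⊔ x∈xs)

Δ≡-attained : (G : Graph) {D : ℕ} → (∀ u → deg G u ≤ D) → ∀ u₀ → deg G u₀ ≡ D → Δ G ≡ D
Δ≡-attained G {D} deg≤D u₀ deg≡D = ≤-antisym
  (foldr-preservesᵇ {P = _≤ D} ⊔-lub z≤n (All.map⁺ (All.tabulate⁺ deg≤D)))
  (subst (_≤ Δ G) deg≡D (∈⇒≤-foldr-⊔ (∈-map⁺ (deg G) (∈-allFin u₀))))

forwardDegree : (G : Graph) → Fin (V G) → ℕ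
forwardDegree G u = countTrue (V G) (λ v → (toℕ u <ᵇ toℕ v) ∧ adj G u v)

F≡false-outside : ∀ {G} (H : Subgraph G) {u v} → S H u ≡ false → F H u v ≡ false
F≡false-outside H {u} {v} Su = ¬-not λ Fuv → contradiction (trans (sym (F⊆S H u v Fuv)) Su) λ ()

𝟙-∧-mono : ∀ a {b c} → (b ≡ true → c ≡ true) → 𝟙 (a ∧ b) ≤ 𝟙 (a ∧ c)
𝟙-∧-mono false b⇒c = z≤n
𝟙-∧-mono true {false} b⇒c = z≤n
𝟙-∧-mono true {true} b⇒c rewrite b⇒c refl = ≤-refl

𝟙-∧-false : ∀ a {b} → (a ≡ true → b ≡ false) → 𝟙 (a ∧ b) ≡ 0
𝟙-∧-false false a⇒¬b = refl
𝟙-∧-false true a⇒¬b rewrite a⇒¬b refl = refl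

<ᵇ≡true⇒< : ∀ {m n} → (m <ᵇ n) ≡ true → m < n
<ᵇ≡true⇒< {m} {n} = <ᵇ⇒< m n ∘ Equivalence.from T-≡

forwardDegree≤⇒madLessThan : (G : Graph) (d : ℕ) → (∀ u → forwardDegree G u ≤ suc d) →
  madLessThan G (2 * suc d)
forwardDegree≤⇒madLessThan G d fwd≤ H 0<|H| = begin-strict
  2 * ecount H                         ≡⟨ cong (2 *_) (ecount≡∑ H) ⟩
  2 * ∑[ u < N ] out u                 <⟨ *-monoʳ-< 2 (∑-mono-< out≤ u₀ out-u₀<) ⟩
  2 * ∑[ u < N ] (suc d * 𝟙 (S H u))   ≡⟨ cong (2 *_) (sym (*-distribˡ-sum (suc d) (𝟙 ∘ S H))) ⟩
  2 * (suc d * ∑[ u < N ] 𝟙 (S H u))   ≡⟨ sym (*-assoc 2 (suc d) _) ⟩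
  2 * suc d * ∑[ u < N ] 𝟙 (S H u)     ≡⟨ cong (2 * suc d *_) (sym (countTrue≡∑ N (S H))) ⟩
  2 * suc d * vcount H                 ∎
  where
  open ≤-Reasoning
  N : ℕ
  N = V G
  forward : Fin N → Fin N → Bool
  forward u v = (toℕ u <ᵇ toℕ v) ∧ F H u v
  out : Fin N → ℕ
  out u = ∑[ v < N ] 𝟙 (forward u v)

  out≤ : ∀ u → out u ≤ suc d * 𝟙 (S H u)
  out≤ u with S H u in Su
  ... | true = begin
    out u                                         ≤⟨ ∑-mono-≤ (λ v → 𝟙-∧-mono (toℕ u <ᵇ toℕ v) (F⊆E H u v)) ⟩
    ∑[ v < N ] 𝟙 ((toℕ u <ᵇ toℕ v) ∧ adj G u v)   ≡⟨ sym (countTrue≡∑ N _) ⟩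
    forwardDegree G u                             ≤⟨ fwd≤ u ⟩
    suc d                                         ≡⟨ sym (*-identityʳ (suc d)) ⟩
    suc d * 1                                     ∎
  ... | false = begin
    out u         ≡⟨ sum-cong-≗ {x = 𝟙 ∘ forward u} (λ v → 𝟙-∧-false (toℕ u <ᵇ toℕ v) (λ _ → F≡false-outside H Su)) ⟩
    ∑[ v < N ] 0  ≡⟨ sum-replicate-zero N ⟩
    0             ≡⟨ sym (*-zeroʳ (suc d)) ⟩
    suc d * 0     ∎

  last : ∃ λ u → S H u ≡ true × (∀ v → toℕ u < toℕ v → S H v ≡ false)
  last = lastTrue (S H) (∑𝟙-pos⇒∃ (S H) (subst (0 <_) (countTrue≡∑ N (S H)) 0<|H|))
  u₀ : Fin N
  u₀ = proj₁ last

  out-u₀< : out u₀ < suc d * 𝟙 (S H u₀)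
  out-u₀< = begin-strict
    out u₀              ≡⟨ sum-cong-≗ {x = 𝟙 ∘ forward u₀} (λ v → 𝟙-∧-false (toℕ u₀ <ᵇ toℕ v) (no-later v)) ⟩
    ∑[ v < N ] 0        ≡⟨ sum-replicate-zero N ⟩
    0                   <⟨ s≤s z≤n ⟩
    suc d * 1           ≡⟨ cong (λ b → suc d * 𝟙 b) (sym (proj₁ (proj₂ last))) ⟩
    suc d * 𝟙 (S H u₀)  ∎
    where
    no-later : ∀ v → (toℕ u₀ <ᵇ toℕ v) ≡ true → F H u₀ v ≡ false
    no-later v u₀<v = trans (Fsym H u₀ v) (F≡false-outside H (proj₂ (proj₂ last) v (<ᵇ≡true⇒< u₀<v)))

HasClique⇒ChromaticAtLeast : ∀ {N} (A : Fin N → Fin N → Bool) M → HasClique A M → ChromaticAtLeast A M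
HasClique⇒ChromaticAtLeast A M (f , f-injective , f-clique) k c proper = injective⇒≤ c∘f-injective
  where
  c∘f-injective : ∀ {a b} → c (f a) ≡ c (f b) → a ≡ b
  c∘f-injective {a} {b} same with a ≟ b
  ... | yes a≡b = a≡b
  ... | no a≢b = contradiction same (proper (f a) (f b) (f-clique a b a≢b))

sqAdj-viaMidpoint : (G : Graph) {u v : Fin (V G)} (w : Fin (V G)) → ¬ u ≡ v →
  (adj G u v ∨ (adj G u w ∧ adj G w v)) ≡ true → sqAdj G u v ≡ true
sqAdj-viaMidpoint G {u} {v} w u≢v reach with u ≟ v
... | yes u≡v = contradiction u≡v u≢v
... | no _ with adj G u v
...   | true = refl
...   | false = Equivalence.to T-≡
        (any⁺ _ (Any.map (λ { refl → Equivalence.from T-≡ reach }) (∈-allFin w)))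

-- The construction

module Construction (k : ℕ) where

  m : ℕ
  m = suc k

  data Member : Set where
    p q : Fin m → Member
    y x h₁ h₂ h₃ h₄ : Member

  data Vertex : Set where
    connector : Fin m → Fin m → Vertex
    hub : Vertex
    member : Member → Vertex

  -- Each edge is listed once, oriented towards the later vertex of the encoding below.
  -- The leading clauses split on the target first, so that memberArc μ ν
  -- computes to false for an unknown source μ whenever ν has no incoming arc.
  memberArc : Member → Member → Bool
  memberArc _ (p _) = false
  memberArc _ (q _) = false
  memberArc _ y = false
  memberArc _ x = false
  memberArc (p _) h₂ = true
  memberArc (p _) h₄ = true
  memberArc (q _) h₁ = true
  memberArc (q _) h₃ = true
  memberArc y h₁ = true
  memberArc y h₄ = true
  memberArc x h₂ = true
  memberArc x h₃ = true
  memberArc h₁ h₂ = true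
  memberArc h₃ h₄ = true
  memberArc _ _ = false

  arc : Vertex → Vertex → Bool
  arc (connector i _) (member (p i′)) = does (i ≟ i′)
  arc (connector _ j) (member (q j′)) = does (j ≟ j′)
  arc hub (member y) = true
  arc hub (member x) = true
  arc (member μ) (member ν) = memberArc μ ν
  arc _ _ = false

  edge : Vertex → Vertex → Bool
  edge a b = arc a b ∨ arc b a

  arc-irrefl : ∀ a → arc a a ≡ false
  arc-irrefl (connector _ _) = refl
  arc-irrefl hub = refl
  arc-irrefl (member (p _)) = refl
  arc-irrefl (member (q _)) = refl
  arc-irrefl (member y) = refl
  arc-irrefl (member x) = refl
  arc-irrefl (member h₁) = refl
  arc-irrefl (member h₂) = refl
  arc-irrefl (member h₃) = refl
  arc-irrefl (member h₄) = refl

  L : ℕ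
  L = m + (m + 6)

  special : Fin 6 → Member
  special 0F = y
  special 1F = x
  special 2F = h₁
  special 3F = h₂
  special 4F = h₃
  special 5F = h₄

  decodeMember : Fin L → Member
  decodeMember a = [ p , [ q , special ]′ ∘ splitAt m ]′ (splitAt m a)

  encodeMember : Member → Fin L
  encodeMember (p i) = i ↑ˡ (m + 6)
  encodeMember (q j) = m ↑ʳ (j ↑ˡ 6)
  encodeMember y = m ↑ʳ (m ↑ʳ 0F)
  encodeMember x = m ↑ʳ (m ↑ʳ 1F)
  encodeMember h₁ = m ↑ʳ (m ↑ʳ 2F)
  encodeMember h₂ = m ↑ʳ (m ↑ʳ 3F)
  encodeMember h₃ = m ↑ʳ (m ↑ʳ 4F)
  encodeMember h₄ = m ↑ʳ (m ↑ʳ 5F)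

  decodeMember-special : ∀ s → decodeMember (m ↑ʳ (m ↑ʳ s)) ≡ special s
  decodeMember-special s rewrite splitAt-↑ʳ m (m + 6) (m ↑ʳ s) | splitAt-↑ʳ m 6 s = refl

  encodeMember-special : ∀ s → encodeMember (special s) ≡ m ↑ʳ (m ↑ʳ s)
  encodeMember-special 0F = refl
  encodeMember-special 1F = refl
  encodeMember-special 2F = refl
  encodeMember-special 3F = refl
  encodeMember-special 4F = refl
  encodeMember-special 5F = refl

  decodeMember-encodeMember : ∀ μ → decodeMember (encodeMember μ) ≡ μ
  decodeMember-encodeMember (p i) rewrite splitAt-↑ˡ m i (m + 6) = refl
  decodeMember-encodeMember (q j) rewrite splitAt-↑ʳ m (m + 6) (j ↑ˡ 6) | splitAt-↑ˡ m j 6 = refl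
  decodeMember-encodeMember y = decodeMember-special 0F
  decodeMember-encodeMember x = decodeMember-special 1F
  decodeMember-encodeMember h₁ = decodeMember-special 2F
  decodeMember-encodeMember h₂ = decodeMember-special 3F
  decodeMember-encodeMember h₃ = decodeMember-special 4F
  decodeMember-encodeMember h₄ = decodeMember-special 5F

  encodeMember-decodeMember : ∀ a → encodeMember (decodeMember a) ≡ a
  encodeMember-decodeMember a with splitAt m a in eq
  ... | inj₁ i = splitAt⁻¹-↑ˡ eq
  ... | inj₂ b with splitAt m b in eq′
  ...   | inj₁ j = trans (cong (m ↑ʳ_) (splitAt⁻¹-↑ˡ eq′)) (splitAt⁻¹-↑ʳ eq)
  ...   | inj₂ s = trans (encodeMember-special s) (trans (cong (m ↑ʳ_) (splitAt⁻¹-↑ʳ eq′)) (splitAt⁻¹-↑ʳ eq))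

  N : ℕ
  N = m * m + suc L

  decodeRest : Fin (suc L) → Vertex
  decodeRest zero = hub
  decodeRest (suc a) = member (decodeMember a)

  decodeConnector : Fin (m * m) → Vertex
  decodeConnector c = uncurry connector (remQuot m c)

  decode : Fin N → Vertex
  decode t = [ decodeConnector , decodeRest ]′ (splitAt (m * m) t)

  encode : Vertex → Fin N
  encode (connector i j) = combine i j ↑ˡ suc L
  encode hub = (m * m) ↑ʳ zero
  encode (member μ) = (m * m) ↑ʳ suc (encodeMember μ)

  decode-↑ʳ : ∀ a → decode ((m * m) ↑ʳ a) ≡ decodeRest a
  decode-↑ʳ a = cong [ decodeConnector , decodeRest ]′ (splitAt-↑ʳ (m * m) (suc L) a)

  decode-encode : ∀ a → decode (encode a) ≡ a
  decode-encode (connector i j) =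
    trans (cong [ decodeConnector , decodeRest ]′ (splitAt-↑ˡ (m * m) (combine i j) (suc L)))
          (cong (uncurry connector) (remQuot-combine i j))
  decode-encode hub = decode-↑ʳ zero
  decode-encode (member μ) = trans (decode-↑ʳ (suc (encodeMember μ))) (cong member (decodeMember-encodeMember μ))

  encode-decode : ∀ t → encode (decode t) ≡ t
  encode-decode t with splitAt (m * m) t in eq
  ... | inj₁ c = trans (cong (_↑ˡ suc L) (combine-remQuot {m} m c)) (splitAt⁻¹-↑ˡ eq)
  ... | inj₂ zero = splitAt⁻¹-↑ʳ eq
  ... | inj₂ (suc a) = trans (cong (λ b → (m * m) ↑ʳ suc b) (encodeMember-decodeMember a)) (splitAt⁻¹-↑ʳ eq)

  encode-injective : ∀ {a b} → encode a ≡ encode b → a ≡ b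
  encode-injective {a} {b} e = trans (sym (decode-encode a)) (trans (cong decode e) (decode-encode b))

  G : Graph
  G = record
    { V = N
    ; adj = λ u v → edge (decode u) (decode v)
    ; sym = λ u v → ∨-comm (arc (decode u) (decode v)) (arc (decode v) (decode u))
    ; irrefl = λ v → cong (λ b → b ∨ b) (arc-irrefl (decode v))
    }

  count : (Vertex → Bool) → ℕ
  count g = ∑[ i < m ] ∑[ j < m ] 𝟙 (g (connector i j))
          + (𝟙 (g hub)
          + (∑[ i < m ] 𝟙 (g (member (p i)))
          + (∑[ j < m ] 𝟙 (g (member (q j)))
          + ∑[ s < 6 ] 𝟙 (g (member (special s))))))

  count-≡ : ∀ g {c r s} →
    ∑[ i < m ] ∑[ j < m ] 𝟙 (g (connector i j)) ≡ c →
    ∑[ i < m ] 𝟙 (g (member (p i))) ≡ r →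
    ∑[ j < m ] 𝟙 (g (member (q j))) ≡ s →
    count g ≡ c + (𝟙 (g hub) + (r + (s + ∑[ t < 6 ] 𝟙 (g (member (special t))))))
  count-≡ g refl refl refl = refl

  count-≤ : ∀ g {b c r s} →
    ∑[ i < m ] ∑[ j < m ] 𝟙 (g (connector i j)) ≡ c →
    ∑[ i < m ] 𝟙 (g (member (p i))) ≡ r →
    ∑[ j < m ] 𝟙 (g (member (q j))) ≡ s →
    c + (𝟙 (g hub) + (r + (s + ∑[ t < 6 ] 𝟙 (g (member (special t)))))) ≤ b →
    count g ≤ b
  count-≤ g C≡c P≡r Q≡s = ≤-trans (≤-reflexive (count-≡ g C≡c P≡r Q≡s))

  ∑-decodeMember : ∀ h → ∑[ a < L ] 𝟙 (h (decodeMember a))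
    ≡ ∑[ i < m ] 𝟙 (h (p i)) + (∑[ j < m ] 𝟙 (h (q j)) + ∑[ s < 6 ] 𝟙 (h (special s)))
  ∑-decodeMember h = trans (∑-++ m (𝟙 ∘ h ∘ decodeMember)) (cong₂ _+_
    (∑-cong (𝟙 ∘ h) (decodeMember-encodeMember ∘ p))
    (trans (∑-++ m (𝟙 ∘ h ∘ decodeMember ∘ (m ↑ʳ_))) (cong₂ _+_
      (∑-cong (𝟙 ∘ h) (decodeMember-encodeMember ∘ q))
      (∑-cong (𝟙 ∘ h) decodeMember-special))))

  ∑-decode : ∀ g → ∑[ t < N ] 𝟙 (g (decode t)) ≡ count g
  ∑-decode g = begin
    ∑[ t < N ] 𝟙 (g (decode t))
      ≡⟨ ∑-++ (m * m) (𝟙 ∘ g ∘ decode) ⟩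
    ∑[ c < m * m ] 𝟙 (g (decode (c ↑ˡ suc L))) + ∑[ a < suc L ] 𝟙 (g (decode ((m * m) ↑ʳ a)))
      ≡⟨ cong₂ _+_ (∑-combine m {m} (λ c → 𝟙 (g (decode (c ↑ˡ suc L)))))
                   (∑-cong (𝟙 ∘ g) decode-↑ʳ) ⟩
    ∑[ i < m ] ∑[ j < m ] 𝟙 (g (decode (encode (connector i j)))) + ∑[ a < suc L ] 𝟙 (g (decodeRest a))
      ≡⟨ cong₂ _+_ (∑-cong id (λ i → ∑-cong (𝟙 ∘ g) (decode-encode ∘ connector i)))
                   (cong (𝟙 (g hub) +_) (∑-decodeMember (g ∘ member))) ⟩
    count g ∎
    where open ≡-Reasoning

  connectors-at-p : ∀ i → ∑[ i′ < m ] ∑[ j < m ] 𝟙 (does (i′ ≟ i)) ≡ m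
  connectors-at-p i = trans (∑-comm {m} {m} (λ i′ _ → 𝟙 (does (i′ ≟ i))))
                            (trans (∑-cong {n = m} id (λ _ → ∑-𝟙-≟ʳ i)) (∑-one m))

  connectors-at-q : ∀ j → ∑[ i < m ] ∑[ j′ < m ] 𝟙 (does (j′ ≟ j)) ≡ m
  connectors-at-q j = trans (∑-cong {n = m} id (λ _ → ∑-𝟙-≟ʳ j)) (∑-one m)

  ∑-𝟙-≟-∨false : ∀ (i : Fin m) → ∑[ i′ < m ] 𝟙 (does (i ≟ i′) ∨ false) ≡ 1
  ∑-𝟙-≟-∨false i = trans (∑-cong 𝟙 (λ i′ → ∨-identityʳ (does (i ≟ i′)))) (∑-𝟙-≟ˡ i)

  ∑0 : ∑[ i < m ] 0 ≡ 0
  ∑0 = sum-replicate-zero m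

  ∑∑0 : ∑[ i < m ] ∑[ j < m ] 0 ≡ 0
  ∑∑0 = ∑∑-zero m m

  degree-h₁ : count (edge (member h₁)) ≡ m + 2
  degree-h₁ = count-≡ (edge (member h₁)) ∑∑0 ∑0 (∑-one m)

  degree≤ : ∀ a → count (edge a) ≤ m + 2
  degree≤ (connector i j) =
    count-≤ (edge (connector i j)) ∑∑0 (∑-𝟙-≟-∨false i) (∑-𝟙-≟-∨false j) (m≤n+m 2 m)
  degree≤ hub = count-≤ (edge hub) ∑∑0 ∑0 ∑0 (m≤n+m 2 m)
  degree≤ (member (p i)) = count-≤ (edge (member (p i))) (connectors-at-p i) ∑0 ∑0 ≤-refl
  degree≤ (member (q j)) = count-≤ (edge (member (q j))) (connectors-at-q j) ∑0 ∑0 ≤-refl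
  degree≤ (member y) = count-≤ (edge (member y)) ∑∑0 ∑0 ∑0 (s≤s (m≤n+m 2 k))
  degree≤ (member x) = count-≤ (edge (member x)) ∑∑0 ∑0 ∑0 (s≤s (m≤n+m 2 k))
  degree≤ (member h₁) = ≤-reflexive degree-h₁
  degree≤ (member h₂) = count-≤ (edge (member h₂)) ∑∑0 (∑-one m) ∑0 ≤-refl
  degree≤ (member h₃) = count-≤ (edge (member h₃)) ∑∑0 ∑0 (∑-one m) ≤-refl
  degree≤ (member h₄) = count-≤ (edge (member h₄)) ∑∑0 (∑-one m) ∑0 ≤-refl

  deg≡count : ∀ u → deg G u ≡ count (edge (decode u))
  deg≡count u = trans (countTrue≡∑ N _) (∑-decode (edge (decode u)))

  Δ≡m+2 : Δ G ≡ m + 2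
  Δ≡m+2 = Δ≡-attained G (λ u → subst (_≤ m + 2) (sym (deg≡count u)) (degree≤ (decode u)))
    (encode (member h₁)) (trans (deg≡count (encode (member h₁)))
                                (trans (cong (count ∘ edge) (decode-encode (member h₁))) degree-h₁))

  special-< : ∀ (s t : Fin 6) → T (toℕ s <ᵇ toℕ t) → toℕ (m ↑ʳ (m ↑ʳ s)) < toℕ (m ↑ʳ (m ↑ʳ t))
  special-< s t s<t = ↑ʳ-mono-< m (↑ʳ-mono-< m (<ᵇ⇒< (toℕ s) (toℕ t) s<t))

  memberArc-increasing : ∀ μ ν → memberArc μ ν ≡ true → toℕ (encodeMember μ) < toℕ (encodeMember ν)
  memberArc-increasing (p i) h₂ _ = ↑ˡ<↑ʳ i (m ↑ʳ 3F)
  memberArc-increasing (p i) h₄ _ = ↑ˡ<↑ʳ i (m ↑ʳ 5F)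
  memberArc-increasing (q j) h₁ _ = ↑ʳ-mono-< m (↑ˡ<↑ʳ j 2F)
  memberArc-increasing (q j) h₃ _ = ↑ʳ-mono-< m (↑ˡ<↑ʳ j 4F)
  memberArc-increasing y h₁ _ = special-< 0F 2F _
  memberArc-increasing y h₄ _ = special-< 0F 5F _
  memberArc-increasing x h₂ _ = special-< 1F 3F _
  memberArc-increasing x h₃ _ = special-< 1F 4F _
  memberArc-increasing h₁ h₂ _ = special-< 2F 3F _
  memberArc-increasing h₃ h₄ _ = special-< 4F 5F _

  arc-increasing : ∀ a b → arc a b ≡ true → toℕ (encode a) < toℕ (encode b)
  arc-increasing (connector i j) (member (p _)) _ = ↑ˡ<↑ʳ (combine i j) _
  arc-increasing (connector i j) (member (q _)) _ = ↑ˡ<↑ʳ (combine i j) _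
  arc-increasing hub (member y) _ = ↑ʳ-mono-< (m * m) (s≤s z≤n)
  arc-increasing hub (member x) _ = ↑ʳ-mono-< (m * m) (s≤s z≤n)
  arc-increasing (member μ) (member ν) μ→ν = ↑ʳ-mono-< (m * m) (s≤s (memberArc-increasing μ ν μ→ν))

  arc-backward : ∀ u v → toℕ u < toℕ v → arc (decode v) (decode u) ≡ false
  arc-backward u v u<v = ¬-not λ v→u → <-asym u<v
    (subst₂ (λ a b → toℕ a < toℕ b) (encode-decode v) (encode-decode u) (arc-increasing (decode v) (decode u) v→u))

  forward-edge≤arc : ∀ u v → 𝟙 ((toℕ u <ᵇ toℕ v) ∧ adj G u v) ≤ 𝟙 (arc (decode u) (decode v))
  forward-edge≤arc u v with toℕ u <ᵇ toℕ v in u<v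
  ... | false = z≤n
  ... | true rewrite arc-backward u v (<ᵇ≡true⇒< u<v) | ∨-identityʳ (arc (decode u) (decode v)) = ≤-refl

  later-specials≤2 : ∀ μ → ∑[ s < 6 ] 𝟙 (memberArc μ (special s)) ≤ 2
  later-specials≤2 (p _) = ≤-refl
  later-specials≤2 (q _) = ≤-refl
  later-specials≤2 y = ≤-refl
  later-specials≤2 x = ≤-refl
  later-specials≤2 h₁ = s≤s z≤n
  later-specials≤2 h₂ = z≤n
  later-specials≤2 h₃ = s≤s z≤n
  later-specials≤2 h₄ = z≤n

  outDegree≤2 : ∀ a → count (arc a) ≤ 2
  outDegree≤2 (connector i j) = count-≤ (arc (connector i j)) ∑∑0 (∑-𝟙-≟ˡ i) (∑-𝟙-≟ˡ j) ≤-refl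
  outDegree≤2 hub = count-≤ (arc hub) ∑∑0 ∑0 ∑0 ≤-refl
  outDegree≤2 (member μ) = count-≤ (arc (member μ)) ∑∑0 ∑0 ∑0 (later-specials≤2 μ)

  forwardDegree≤2 : ∀ u → forwardDegree G u ≤ 2
  forwardDegree≤2 u = begin
    forwardDegree G u                               ≡⟨ countTrue≡∑ N (λ v → (toℕ u <ᵇ toℕ v) ∧ adj G u v) ⟩
    ∑[ v < N ] 𝟙 ((toℕ u <ᵇ toℕ v) ∧ adj G u v)     ≤⟨ ∑-mono-≤ (forward-edge≤arc u) ⟩
    ∑[ v < N ] 𝟙 (arc (decode u) (decode v))        ≡⟨ ∑-decode (arc (decode u)) ⟩
    count (arc (decode u))                          ≤⟨ outDegree≤2 (decode u) ⟩
    2                                               ∎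
    where open ≤-Reasoning

  madLessThan-4 : madLessThan G 4
  madLessThan-4 = forwardDegree≤⇒madLessThan G 1 forwardDegree≤2

  commonNeighbour : Member → Member → Vertex
  commonNeighbour (p i) (q j) = connector i j
  commonNeighbour (q j) (p i) = connector i j
  commonNeighbour y x = hub
  commonNeighbour x y = hub
  commonNeighbour (p _) (p _) = member h₂
  commonNeighbour (p _) y = member h₄
  commonNeighbour (p _) x = member h₂
  commonNeighbour (p _) h₁ = member h₂
  commonNeighbour (p _) h₃ = member h₄
  commonNeighbour (q _) (q _) = member h₁
  commonNeighbour (q _) y = member h₁
  commonNeighbour (q _) x = member h₃
  commonNeighbour (q _) h₂ = member h₁
  commonNeighbour (q _) h₄ = member h₃
  commonNeighbour y (p _) = member h₄
  commonNeighbour y (q _) = member h₁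
  commonNeighbour y h₂ = member h₁
  commonNeighbour y h₃ = member h₄
  commonNeighbour x (p _) = member h₂
  commonNeighbour x (q _) = member h₃
  commonNeighbour x h₁ = member h₂
  commonNeighbour x h₄ = member h₃
  commonNeighbour h₁ (p _) = member h₂
  commonNeighbour h₁ x = member h₂
  commonNeighbour h₁ h₃ = member (q 0F)
  commonNeighbour h₁ h₄ = member y
  commonNeighbour h₂ (q _) = member h₁
  commonNeighbour h₂ y = member h₁
  commonNeighbour h₂ h₃ = member x
  commonNeighbour h₂ h₄ = member (p 0F)
  commonNeighbour h₃ (p _) = member h₄
  commonNeighbour h₃ y = member h₄
  commonNeighbour h₃ h₁ = member (q 0F)
  commonNeighbour h₃ h₂ = member x
  commonNeighbour h₄ (q _) = member h₃
  commonNeighbour h₄ x = member h₃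
  commonNeighbour h₄ h₁ = member y
  commonNeighbour h₄ h₂ = member (p 0F)
  -- the remaining pairs are adjacent
  commonNeighbour _ _ = hub

  atDistance≤2 : ∀ μ ν → ¬ μ ≡ ν → let w = commonNeighbour μ ν in
    (edge (member μ) (member ν) ∨ (edge (member μ) w ∧ edge w (member ν))) ≡ true
  atDistance≤2 (p _) (p _) _ = refl
  atDistance≤2 (p i) (q j) _ rewrite dec-true (i ≟ i) refl | dec-true (j ≟ j) refl = refl
  atDistance≤2 (p _) y _ = refl
  atDistance≤2 (p _) x _ = refl
  atDistance≤2 (p _) h₁ _ = refl
  atDistance≤2 (p _) h₂ _ = refl
  atDistance≤2 (p _) h₃ _ = refl
  atDistance≤2 (p _) h₄ _ = refl
  atDistance≤2 (q j) (p i) _ rewrite dec-true (i ≟ i) refl | dec-true (j ≟ j) refl = refl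
  atDistance≤2 (q _) (q _) _ = refl
  atDistance≤2 (q _) y _ = refl
  atDistance≤2 (q _) x _ = refl
  atDistance≤2 (q _) h₁ _ = refl
  atDistance≤2 (q _) h₂ _ = refl
  atDistance≤2 (q _) h₃ _ = refl
  atDistance≤2 (q _) h₄ _ = refl
  atDistance≤2 y (p _) _ = refl
  atDistance≤2 y (q _) _ = refl
  atDistance≤2 y y μ≢ν = contradiction refl μ≢ν
  atDistance≤2 y x _ = refl
  atDistance≤2 y h₁ _ = refl
  atDistance≤2 y h₂ _ = refl
  atDistance≤2 y h₃ _ = refl
  atDistance≤2 y h₄ _ = refl
  atDistance≤2 x (p _) _ = refl
  atDistance≤2 x (q _) _ = refl
  atDistance≤2 x y _ = refl
  atDistance≤2 x x μ≢ν = contradiction refl μ≢ν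
  atDistance≤2 x h₁ _ = refl
  atDistance≤2 x h₂ _ = refl
  atDistance≤2 x h₃ _ = refl
  atDistance≤2 x h₄ _ = refl
  atDistance≤2 h₁ (p _) _ = refl
  atDistance≤2 h₁ (q _) _ = refl
  atDistance≤2 h₁ y _ = refl
  atDistance≤2 h₁ x _ = refl
  atDistance≤2 h₁ h₁ μ≢ν = contradiction refl μ≢ν
  atDistance≤2 h₁ h₂ _ = refl
  atDistance≤2 h₁ h₃ _ = refl
  atDistance≤2 h₁ h₄ _ = refl
  atDistance≤2 h₂ (p _) _ = refl
  atDistance≤2 h₂ (q _) _ = refl
  atDistance≤2 h₂ y _ = refl
  atDistance≤2 h₂ x _ = refl
  atDistance≤2 h₂ h₁ _ = refl
  atDistance≤2 h₂ h₂ μ≢ν = contradiction refl μ≢ν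
  atDistance≤2 h₂ h₃ _ = refl
  atDistance≤2 h₂ h₄ _ = refl
  atDistance≤2 h₃ (p _) _ = refl
  atDistance≤2 h₃ (q _) _ = refl
  atDistance≤2 h₃ y _ = refl
  atDistance≤2 h₃ x _ = refl
  atDistance≤2 h₃ h₁ _ = refl
  atDistance≤2 h₃ h₂ _ = refl
  atDistance≤2 h₃ h₃ μ≢ν = contradiction refl μ≢ν
  atDistance≤2 h₃ h₄ _ = refl
  atDistance≤2 h₄ (p _) _ = refl
  atDistance≤2 h₄ (q _) _ = refl
  atDistance≤2 h₄ y _ = refl
  atDistance≤2 h₄ x _ = refl
  atDistance≤2 h₄ h₁ _ = refl
  atDistance≤2 h₄ h₂ _ = refl
  atDistance≤2 h₄ h₃ _ = refl
  atDistance≤2 h₄ h₄ μ≢ν = contradiction refl μ≢ν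

  member-injective : ∀ {μ ν} → member μ ≡ member ν → μ ≡ ν
  member-injective refl = refl

  decodeMember-injective : ∀ {a b} → decodeMember a ≡ decodeMember b → a ≡ b
  decodeMember-injective {a} {b} e =
    trans (sym (encodeMember-decodeMember a)) (trans (cong encodeMember e) (encodeMember-decodeMember b))

  adj-encode : ∀ a b → adj G (encode a) (encode b) ≡ edge a b
  adj-encode a b = cong₂ edge (decode-encode a) (decode-encode b)

  sqAdj-members : ∀ μ ν → ¬ μ ≡ ν → sqAdj G (encode (member μ)) (encode (member ν)) ≡ true
  sqAdj-members μ ν μ≢ν = sqAdj-viaMidpoint G (encode w) (μ≢ν ∘ member-injective ∘ encode-injective)
    (trans (cong₂ _∨_ (adj-encode (member μ) (member ν))
                         (cong₂ _∧_ (adj-encode (member μ) w) (adj-encode w (member ν))))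
           (atDistance≤2 μ ν μ≢ν))
    where
    w : Vertex
    w = commonNeighbour μ ν

  clique : HasClique (sqAdj G) L
  clique = vertexOf , decodeMember-injective ∘ member-injective ∘ encode-injective , vertexOf-adjacent
    where
    vertexOf : Fin L → Fin N
    vertexOf a = encode (member (decodeMember a))
    vertexOf-adjacent : ∀ a b → ¬ a ≡ b → sqAdj G (vertexOf a) (vertexOf b) ≡ true
    vertexOf-adjacent a b a≢b = sqAdj-members (decodeMember a) (decodeMember b) (a≢b ∘ decodeMember-injective)

  cliqueSize : 2 * (m + 2) + 2 ≡ L
  cliqueSize = solve 1 (λ m → con 2 :* (m :+ con 2) :+ con 2 := m :+ (m :+ con 6)) refl m
    where open +-*-Solver

mainTheorem2 : (n : ℕ) → 2 ≤ n →
    Σ Graph λ G →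
      (Δ G ≡ n + 1) × madLessThan G 4
      × HasClique (sqAdj G) (2 * Δ G + 2)
      × ChromaticAtLeast (sqAdj G) (2 * Δ G + 2)
mainTheorem2 zero ()
mainTheorem2 (suc zero) (s≤s ())
mainTheorem2 (suc (suc k)) _ = G , Δ≡n+1 , madLessThan-4 , clique′ , HasClique⇒ChromaticAtLeast (sqAdj G) _ clique′
  where
  open Construction k
  Δ≡n+1 : Δ G ≡ suc (suc k) + 1
  Δ≡n+1 = trans Δ≡m+2 (cong suc (+-suc k 1))
  clique′ : HasClique (sqAdj G) (2 * Δ G + 2)
  clique′ = subst (HasClique (sqAdj G)) (sym (trans (cong (λ d → 2 * d + 2) Δ≡m+2) cliqueSize)) clique
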